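{- Let $G$ be a circle graph and let $\{G_1, G_2\}$ be a simple split decomposition of $G$ with marker vertex $v$. If $G_1$ has a $k_1$-polygon representation and $G_2$ has a $k_2$-polygon representation, then $G$ has a $(k_1+k_2)$-polygon representation. Furthermore, if $G_1$ has a $k_1$-polygon representation in which the chord of $v$ is close to $q$ corners, then $G$ has a $(k_1+k_2-q)$-polygon representation.
   Context: For a graph $G=(V,E)$ and $W \subseteq V$, $N(W)$ is the set of vertices outside $W$ adjacent to some vertex of $W$. A split of $G$ is a partition $\{V_1,V_2\}$ of $V$ with $|V_1|>1$, $|V_2|>1$, such that the set of edges between $V_1$ and $V_2$ is exactly $\{xy : x \in N(V_2), y \in N(V_1)\}$. For such a split, $\{G_1,G_2\}$ is a simple split decomposition of $G$, where $G_1$ is $G[V_1]$ plus a new vertex $v$ with neighbourhood $N_G(V_2)$, and $G_2$ is $G[V_2]$ plus the vertex $v$ with neighbourhood $N_G(V_1)$; $v$ is the marker vertex. A circle representation of a graph is a set of chords of a circle, one per vertex, with distinct endpoints, whose intersection graph is the graph. For $k \ge 2$, a $k$-polygon representation is a circle representation together with $k$ points (corners) on the circle, distinct from chord endpoints, such that each chord has a corner in each of the two open arcs determined by its endpoints (for $k=2$ this is a permutation representation; for $k\ge3$ it corresponds to chords of a convex $k$-gon with endpoints on distinct sides). The sides are the open arcs between cyclically consecutive corners; two sides meet at each corner. A chord endpoint $e$ on a side meeting at corner $\tau$ is close to $\tau$ if no other chord endpoint on that side lies between $\tau$ and $e$; a chord is close to $\tau$ if at least one of its endpoints is close to $\tau$.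 -}

module Defs where

open import Data.Nat using (ℕ; _<_; _≤_)
open import Data.Bool using (Bool; true; false; not)
open import Data.Fin using (Fin)
open import Data.Fin.Subset using (Subset; _∈_; ∣_∣)
open import Data.Product using (Σ; ∃; _×_; _,_; proj₁; proj₂)
open import Data.Sum using (_⊎_; inj₁; inj₂)
open import Data.Unit using (⊤; tt)
open import Data.Empty using (⊥)
open import Relation.Nullary using (¬_)
open import Relation.Binary.PropositionalEquality using (_≡_; _≢_)
open import Function.Bundles using (_⇔_)

record Graph (V : Set) : Set₁ where
  field
    adj    : V → V → Set
    sym    : ∀ {x y} → adj x y → adj y x
    irrefl : ∀ {x} → ¬ adj x x
open Graph public

-- The circle is cut at an arbitrary point, so points on the circle are
-- modelled by natural numbers with their linear order; the cyclic order
-- is recovered via 'InArc'.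

-- q lies in the open arc going (counter-clockwise, i.e. increasing and
-- wrapping around) from a to b.
InArc : ℕ → ℕ → ℕ → Set
InArc a b q = (a < q × q < b) ⊎ (b < a × (a < q ⊎ q < b))

endpointOf : {V : Set} → (V → ℕ) → (V → ℕ) → V → Bool → ℕ
endpointOf l r x true  = l x
endpointOf l r x false = r x

CrossOf : {V : Set} → (V → ℕ) → (V → ℕ) → V → V → Set
CrossOf l r x y = (l x < l y × l y < r x × r x < r y)
                ⊎ (l y < l x × l x < r y × r y < r x)

record CircleRep {V : Set} (G : Graph V) : Set where
  field
    l r      : V → ℕ
    l<r      : ∀ x → l x < r x
    endpoint-inj : ∀ x y b c → endpointOf l r x b ≡ endpointOf l r y c →
                   (x ≡ y × b ≡ c)
    represents   : ∀ x y → adj G x y ⇔ CrossOf l r x y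
  endpoint : V → Bool → ℕ
  endpoint = endpointOf l r
open CircleRep public

IsCircleGraph : {V : Set} → Graph V → Set
IsCircleGraph G = CircleRep G

record PolygonRep {V : Set} (G : Graph V) (k : ℕ) : Set where
  field
    2≤k     : 2 ≤ k
    circ    : CircleRep G
    corner  : Fin k → ℕ
    corner-inj      : ∀ i j → corner i ≡ corner j → i ≡ j
    corner≢endpoint : ∀ i x b → corner i ≢ endpoint circ x b
    inner-corner : ∀ x → ∃ λ i → InArc (l circ x) (r circ x) (corner i)
    outer-corner : ∀ x → ∃ λ i → InArc (r circ x) (l circ x) (corner i)

  -- corners t and t' are cyclically consecutive (t' follows t):
  -- the open arc from t to t' contains no corner; this arc is a side
  Consecutive : Fin k → Fin k → Set
  Consecutive i j = i ≢ j × (∀ m → ¬ InArc (corner i) (corner j) (corner m))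

  EndpointClose : ℕ → Fin k → Set
  EndpointClose p i =
      (∃ λ j → Consecutive i j × InArc (corner i) (corner j) p
             × (∀ y b → ¬ InArc (corner i) p (endpoint circ y b)))
    ⊎ (∃ λ j → Consecutive j i × InArc (corner j) (corner i) p
             × (∀ y b → ¬ InArc p (corner i) (endpoint circ y b)))

  ChordClose : V → Fin k → Set
  ChordClose x i = EndpointClose (l circ x) i ⊎ EndpointClose (r circ x) i

  CloseToCorners : V → ℕ → Set
  CloseToCorners x q =
    Σ (Subset k) λ S → (∀ i → (i ∈ S) ⇔ ChordClose x i) × ∣ S ∣ ≡ q
open PolygonRep public

-- Splits and simple split decompositions.
-- A bipartition {V₁,V₂} of Fin n is given by s : Fin n → Bool,
-- V₁ = s⁻¹(true), V₂ = s⁻¹(false).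

Part : {n : ℕ} → (Fin n → Bool) → Bool → Set
Part s b = Σ _ λ x → s x ≡ b

-- x is in N(V_{b'}) : adjacent to some vertex of the part b'
-- (used only for x outside that part)
AdjToPart : {n : ℕ} → Graph (Fin n) → (Fin n → Bool) → Bool → Fin n → Set
AdjToPart G s b x = ∃ λ z → s z ≡ b × adj G x z

record IsSplit {n : ℕ} (G : Graph (Fin n)) (s : Fin n → Bool) : Set where
  field
    V₁-big : ∃ λ x → ∃ λ y → x ≢ y × s x ≡ true  × s y ≡ true
    V₂-big : ∃ λ x → ∃ λ y → x ≢ y × s x ≡ false × s y ≡ false
    cross-edges : ∀ x y → s x ≡ true → s y ≡ false →
      adj G x y ⇔ (AdjToPart G s false x × AdjToPart G s true y)

-- G_b : G[part b] plus a marker vertex (inj₂ tt) adjacent to N(other part)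
-- restricted to part b.
sideAdj : {n : ℕ} → Graph (Fin n) → (s : Fin n → Bool) → (b : Bool) →
          Part s b ⊎ ⊤ → Part s b ⊎ ⊤ → Set
sideAdj G s b (inj₁ x) (inj₁ y) = adj G (proj₁ x) (proj₁ y)
sideAdj G s b (inj₁ x) (inj₂ _) = AdjToPart G s (not b) (proj₁ x)
sideAdj G s b (inj₂ _) (inj₁ y) = AdjToPart G s (not b) (proj₁ y)
sideAdj G s b (inj₂ _) (inj₂ _) = ⊥

sideGraph : {n : ℕ} → Graph (Fin n) → (s : Fin n → Bool) → (b : Bool) →
            Graph (Part s b ⊎ ⊤)
sideGraph G s b = record { adj = sideAdj G s b ; sym = λ {x} {y} → sy {x} {y} ; irrefl = λ {x} → ir {x} }
  where
  sy : ∀ {x y} → sideAdj G s b x y → sideAdj G s b y x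
  sy {inj₁ x} {inj₁ y} e = sym G e
  sy {inj₁ x} {inj₂ _} e = e
  sy {inj₂ _} {inj₁ y} e = e
  sy {inj₂ _} {inj₂ _} ()
  ir : ∀ {x} → ¬ sideAdj G s b x x
  ir {inj₁ x} e = irrefl G e
  ir {inj₂ _} ()

marker : {n : ℕ} {s : Fin n → Bool} {b : Bool} → Part s b ⊎ ⊤
marker = inj₂ tt

G₁ G₂ : {n : ℕ} → Graph (Fin n) → (s : Fin n → Bool) → Graph _
G₁ G s = sideGraph G s true
G₂ G s = sideGraph G s false

-- Replace the marker chord in the representation of G₁ by the representation of G₂ with its
-- marker chord removed: the arc of G₂'s circle on one side of its marker chord is squeezed in
-- next to one endpoint of G₁'s marker chord, the other arc next to the other endpoint. Chords
-- within G₁ or within G₂ keep their cyclic order, and a chord of V₁ crosses a chord of V₂ exactly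
-- when both crossed the markers, which by the split property is adjacency in G. All k₂ corners of
-- G₂ are kept; a corner of G₁ close to the marker chord can be dropped, since any chord having it
-- between its endpoints also has an endpoint of the marker chord there, and hence a corner of G₂.

module Submission where

open import Defs
open import Data.Nat using (ℕ; _+_; _∸_)
open import Data.Bool using (Bool)
open import Data.Fin using (Fin)
open import Data.Product using (_×_)

open import Axiom.UniquenessOfIdentityProofs using (module Decidable⇒UIP)
open import Data.Bool using (true; false; not)
import Data.Bool as Bool
open import Data.Bool.Properties using (not-¬)
open import Data.Empty using (⊥-elim)
open import Data.Fin using (splitAt; join)
import Data.Fin.Properties as Finₚ
open import Data.Fin.Subset using (Subset; _∈_; ∣_∣; ∁)
import Data.Fin.Subset as Subset
open import Data.Fin.Subset.Properties using (_∈?_; x∉p⇒x∈∁p; ∣∁p∣≡n∸∣p∣; ∣p∣≤n; ∣⊥∣≡0; ∉⊥)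
open import Data.Nat using (zero; suc; s≤s; z≤n; _*_; _<_; _≤_; _⊓_; _⊔_; _<?_; NonZero)
open import Data.Nat.Properties
open import Data.Product using (∃; _,_; proj₁; proj₂)
open import Data.Product.Function.NonDependent.Propositional using (_×-⇔_)
open import Data.Sum using (_⊎_; inj₁; inj₂; swap)
open import Data.Sum.Function.Propositional using (_⊎-⇔_)
open import Data.Sum.Properties using (inj₁-injective)
open import Data.Unit using (⊤; tt)
open import Data.Vec using (_∷_)
open import Data.Vec.Base using (here; there)
open import Function using (_∘_)
open import Function.Bundles using (_⇔_; mk⇔; Equivalence)
open import Function.Construct.Composition using (_⇔-∘_)
open import Function.Construct.Identity using (⇔-id)
open import Function.Construct.Symmetry using (⇔-sym)
open import Function.Properties.Equivalence using (⇔-setoid)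
open import Level using (0ℓ)
open import Relation.Binary.Definitions using (DecidableEquality; tri<; tri≈; tri>)
open import Relation.Binary.PropositionalEquality
  using (_≡_; _≢_; refl; cong; cong₂; trans; subst; ≢-sym; module ≡-Reasoning) renaming (sym to ≡-sym)
import Relation.Binary.Reasoning.Setoid as SetoidReasoning
open import Relation.Nullary using (¬_; yes; no; contradiction)

open Equivalence using (to; from)

private
  variable
    a b c d p q t u w : ℕ

InArc-rotate : InArc u w p → InArc p u w
InArc-rotate (inj₁ (u<p , p<w))          = inj₂ (u<p , inj₁ p<w)
InArc-rotate (inj₂ (w<u , inj₁ u<p))     = inj₂ (u<p , inj₂ w<u)
InArc-rotate (inj₂ (w<u , inj₂ p<w))     = inj₁ (p<w , w<u)

InArc-asym : InArc u w p → ¬ InArc w u p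
InArc-asym (inj₁ (u<p , p<w)) (inj₁ (w<p , p<u))          = <-asym u<p p<u
InArc-asym (inj₁ (u<p , p<w)) (inj₂ (u<w , inj₁ w<p))     = <-asym p<w w<p
InArc-asym (inj₁ (u<p , p<w)) (inj₂ (u<w , inj₂ p<u))     = <-asym u<p p<u
InArc-asym (inj₂ (w<u , inj₁ u<p)) (inj₁ (w<p , p<u))     = <-asym u<p p<u
InArc-asym (inj₂ (w<u , inj₂ p<w)) (inj₁ (w<p , p<u))     = <-asym p<w w<p
InArc-asym (inj₂ (w<u , _)) (inj₂ (u<w , _))              = <-asym w<u u<w

InArc-total : u ≢ w → u ≢ p → w ≢ p → InArc u w p ⊎ InArc w u p
InArc-total {u} {w} {p} u≢w u≢p w≢p with <-cmp u w | <-cmp u p | <-cmp w p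
... | tri≈ _ u≡w _ | _ | _ = contradiction u≡w u≢w
... | _ | tri≈ _ u≡p _ | _ = contradiction u≡p u≢p
... | _ | _ | tri≈ _ w≡p _ = contradiction w≡p w≢p
... | tri< u<w _ _ | tri< u<p _ _ | tri> _ _ p<w = inj₁ (inj₁ (u<p , p<w))
... | tri< u<w _ _ | tri< u<p _ _ | tri< w<p _ _ = inj₂ (inj₂ (u<w , inj₁ w<p))
... | tri< u<w _ _ | tri> _ _ p<u | _            = inj₂ (inj₂ (u<w , inj₂ p<u))
... | tri> _ _ w<u | tri< u<p _ _ | _            = inj₁ (inj₂ (w<u , inj₁ u<p))
... | tri> _ _ w<u | _ | tri> _ _ p<w            = inj₁ (inj₂ (w<u , inj₂ p<w))
... | tri> _ _ w<u | tri> _ _ p<u | tri< w<p _ _ = inj₂ (inj₁ (w<p , p<u))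

InArc-trans : InArc a c b → InArc a d c → InArc b d c
InArc-trans (inj₁ (a<b , b<c)) (inj₁ (_ , c<d))             = inj₁ (b<c , c<d)
InArc-trans (inj₁ (a<b , b<c)) (inj₂ (d<a , inj₁ _))        = inj₂ (<-trans d<a a<b , inj₁ b<c)
InArc-trans (inj₁ (a<b , b<c)) (inj₂ (d<a , inj₂ c<d))      = ⊥-elim (<-asym (<-trans a<b b<c) (<-trans c<d d<a))
InArc-trans (inj₂ (c<a , _)) (inj₁ (a<c , _))               = ⊥-elim (<-asym a<c c<a)
InArc-trans (inj₂ (c<a , _)) (inj₂ (_ , inj₁ a<c))          = ⊥-elim (<-asym a<c c<a)
InArc-trans (inj₂ (c<a , inj₁ a<b)) (inj₂ (d<a , inj₂ c<d)) = inj₂ (<-trans d<a a<b , inj₂ c<d)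
InArc-trans (inj₂ (c<a , inj₂ b<c)) (inj₂ (_ , inj₂ c<d))   = inj₁ (b<c , c<d)

InArc-cong-< : ∀ {a′ b′ c′} → (a < c ⇔ a′ < c′) → (c < b ⇔ c′ < b′) → (b < a ⇔ b′ < a′) →
               InArc a b c ⇔ InArc a′ b′ c′
InArc-cong-< ac cb ba = (ac ×-⇔ cb) ⊎-⇔ (ba ×-⇔ (ac ⊎-⇔ cb))

InArc-unobstructed⁺ : InArc u w c → p ≢ u → p ≢ w → c ≢ u → c ≢ w → c ≢ p →
             ¬ InArc c p u → ¬ InArc c p w → InArc u w p
InArc-unobstructed⁺ u→c→w p≢u p≢w c≢u c≢w c≢p u∉ w∉ with InArc-total c≢p c≢w p≢w
... | inj₁ c→w→p = contradiction c→w→p w∉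
... | inj₂ p→w→c =
  InArc-rotate (InArc-rotate (InArc-trans (InArc-rotate (InArc-rotate p→w→c)) (InArc-rotate u→c→w)))

InArc-unobstructed⁻ : InArc u w c → p ≢ u → p ≢ w → c ≢ u → c ≢ w → c ≢ p →
               ¬ InArc p c u → ¬ InArc p c w → InArc u w p
InArc-unobstructed⁻ u→c→w p≢u p≢w c≢u c≢w c≢p u∉ w∉ with InArc-total (c≢p ∘ ≡-sym) p≢u c≢u
... | inj₁ p→u→c = contradiction p→u→c u∉
... | inj₂ c→u→p = InArc-rotate (InArc-trans (InArc-rotate u→c→w) c→u→p)

Separates : ℕ → ℕ → ℕ → ℕ → Set
Separates p q t u = (InArc p q t × InArc q p u) ⊎ (InArc q p t × InArc p q u)

Separates-swapˡ : Separates p q t u ⇔ Separates q p t u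
Separates-swapˡ = mk⇔ swap swap

Separates-swapʳ : Separates p q t u ⇔ Separates p q u t
Separates-swapʳ = mk⇔ flip flip
  where
  flip : ∀ {p q t u} → Separates p q t u → Separates p q u t
  flip (inj₁ (t∈ , u∈)) = inj₂ (u∈ , t∈)
  flip (inj₂ (t∈ , u∈)) = inj₁ (u∈ , t∈)

¬Separates-point : ¬ Separates p q t t
¬Separates-point (inj₁ (p→t→q , q→t→p)) = InArc-asym p→t→q q→t→p
¬Separates-point (inj₂ (q→t→p , p→t→q)) = InArc-asym p→t→q q→t→p

¬Separates-sameArc : InArc p q t → InArc p q u → ¬ Separates p q t u
¬Separates-sameArc _ p→u→q (inj₁ (_ , q→u→p)) = InArc-asym p→u→q q→u→p
¬Separates-sameArc p→t→q _ (inj₂ (q→t→p , _)) = InArc-asym p→t→q q→t→p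

Separates-cong : ∀ {p′ q′ t′ u′} →
  (InArc p q t ⇔ InArc p′ q′ t′) → (InArc q p u ⇔ InArc q′ p′ u′) →
  (InArc q p t ⇔ InArc q′ p′ t′) → (InArc p q u ⇔ InArc p′ q′ u′) →
  Separates p q t u ⇔ Separates p′ q′ t′ u′
Separates-cong pqt qpu qpt pqu = (pqt ×-⇔ qpu) ⊎-⇔ (qpt ×-⇔ pqu)

CrossOf⇔Separates : ∀ {V : Set} (l r : V → ℕ) {x y} → l x < r x → l y < r y →
                    CrossOf l r x y ⇔ Separates (l x) (r x) (l y) (r y)
CrossOf⇔Separates l r {x} {y} lx<rx ly<ry = mk⇔ cross⇒sep sep⇒cross
  where
  cross⇒sep : CrossOf l r x y → Separates (l x) (r x) (l y) (r y)
  cross⇒sep (inj₁ (lx<ly , ly<rx , rx<ry)) = inj₁ (inj₁ (lx<ly , ly<rx) , inj₂ (lx<rx , inj₁ rx<ry))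
  cross⇒sep (inj₂ (ly<lx , lx<ry , ry<rx)) = inj₂ (inj₂ (lx<rx , inj₂ ly<lx) , inj₁ (lx<ry , ry<rx))
  sep⇒cross : Separates (l x) (r x) (l y) (r y) → CrossOf l r x y
  sep⇒cross (inj₁ (inj₂ (rx<lx , _) , _))                = ⊥-elim (<-asym lx<rx rx<lx)
  sep⇒cross (inj₁ (_ , inj₁ (rx<ry , ry<lx)))            = ⊥-elim (<-asym lx<rx (<-trans rx<ry ry<lx))
  sep⇒cross (inj₁ (inj₁ (lx<ly , ly<rx) , inj₂ (_ , inj₁ rx<ry))) = inj₁ (lx<ly , ly<rx , rx<ry)
  sep⇒cross (inj₁ (inj₁ (lx<ly , _) , inj₂ (_ , inj₂ ry<lx)))     = ⊥-elim (<-asym ly<ry (<-trans ry<lx lx<ly))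
  sep⇒cross (inj₂ (_ , inj₂ (rx<lx , _)))                = ⊥-elim (<-asym lx<rx rx<lx)
  sep⇒cross (inj₂ (inj₁ (rx<ly , ly<lx) , _))            = ⊥-elim (<-asym lx<rx (<-trans rx<ly ly<lx))
  sep⇒cross (inj₂ (inj₂ (_ , inj₂ ly<lx) , inj₁ (lx<ry , ry<rx))) = inj₂ (ly<lx , lx<ry , ry<rx)
  sep⇒cross (inj₂ (inj₂ (_ , inj₁ rx<ly) , inj₁ (_ , ry<rx)))     = ⊥-elim (<-asym ly<ry (<-trans ry<rx rx<ly))

module _ {V : Set} {H : Graph V} (C : CircleRep H) where

  endpoint-≢ : ∀ {x y} → x ≢ y → ∀ b c → endpoint C x b ≢ endpoint C y c
  endpoint-≢ x≢y b c eq = x≢y (proj₁ (endpoint-inj C _ _ b c eq))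

  adj⇔Separates : ∀ x y → adj H x y ⇔
    Separates (endpoint C x true) (endpoint C x false) (endpoint C y true) (endpoint C y false)
  adj⇔Separates x y = CrossOf⇔Separates (l C) (r C) (l<r C x) (l<r C y) ⇔-∘ represents C x y

EndpointInjective : {V : Set} → (V → Bool → ℕ) → Set
EndpointInjective {V} e = ∀ (x y : V) b c → e x b ≡ e y c → x ≡ y × b ≡ c

-- The two endpoints end x true and end x false of a chord may come in either order.
module FromEndpoints {V : Set} (_≟_ : DecidableEquality V)
  (end : V → Bool → ℕ) (end-inj : EndpointInjective end) where

  lo hi : V → ℕ
  lo x = end x true ⊓ end x false
  hi x = end x true ⊔ end x false

  SeparatesEnds : V → V → Set
  SeparatesEnds x y = Separates (end x true) (end x false) (end y true) (end y false)

  EndsRepresent : Graph V → Set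
  EndsRepresent G = ∀ x y → x ≢ y → (adj G x y ⇔ SeparatesEnds x y) ⊎ (adj G y x ⇔ SeparatesEnds y x)

  private
    orientation : ∀ x → (lo x ≡ end x true × hi x ≡ end x false) ⊎ (lo x ≡ end x false × hi x ≡ end x true)
    orientation x with ≤-total (end x true) (end x false)
    ... | inj₁ t≤f = inj₁ (m≤n⇒m⊓n≡m t≤f , m≤n⇒m⊔n≡n t≤f)
    ... | inj₂ f≤t = inj₂ (m≥n⇒m⊓n≡n f≤t , m≥n⇒m⊔n≡m f≤t)

    end-true≢false : ∀ x → end x true ≢ end x false
    end-true≢false x eq with proj₂ (end-inj x x true false eq)
    ... | ()

    lo<hi : ∀ x → lo x < hi x
    lo<hi x = ≤∧≢⇒< (≤-trans (m⊓n≤m _ _) (m≤m⊔n _ _)) lo≢hi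
      where
      lo≢hi : lo x ≢ hi x
      lo≢hi lo≡hi with orientation x
      ... | inj₁ (lo≡ , hi≡) = end-true≢false x (trans (≡-sym lo≡) (trans lo≡hi hi≡))
      ... | inj₂ (lo≡ , hi≡) = end-true≢false x (trans (≡-sym hi≡) (trans (≡-sym lo≡hi) lo≡))

    is-end : ∀ x b → ∃ λ c → endpointOf lo hi x b ≡ end x c
    is-end x true  with ⊓-sel (end x true) (end x false)
    ... | inj₁ eq = true , eq
    ... | inj₂ eq = false , eq
    is-end x false with ⊔-sel (end x true) (end x false)
    ... | inj₁ eq = true , eq
    ... | inj₂ eq = false , eq

    lohi-inj : EndpointInjective (endpointOf lo hi)
    lohi-inj x y b c eq with is-end x b | is-end y c
    ... | b′ , x≡ | c′ , y≡ with end-inj x y b′ c′ (trans (≡-sym x≡) (trans eq y≡))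
    lohi-inj x .x true  true  eq | _ | _ | refl , _ = refl , refl
    lohi-inj x .x false false eq | _ | _ | refl , _ = refl , refl
    lohi-inj x .x true  false eq | _ | _ | refl , _ = ⊥-elim (<-irrefl eq (lo<hi x))
    lohi-inj x .x false true  eq | _ | _ | refl , _ = ⊥-elim (<-irrefl (≡-sym eq) (lo<hi x))

    Separates-lohi : ∀ x y → Separates (lo x) (hi x) (lo y) (hi y) ⇔ SeparatesEnds x y
    Separates-lohi x y with orientation x | orientation y
    ... | inj₁ (lx , hx) | inj₁ (ly , hy) rewrite lx | hx | ly | hy = ⇔-id _
    ... | inj₁ (lx , hx) | inj₂ (ly , hy) rewrite lx | hx | ly | hy = Separates-swapʳ
    ... | inj₂ (lx , hx) | inj₁ (ly , hy) rewrite lx | hx | ly | hy = Separates-swapˡ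
    ... | inj₂ (lx , hx) | inj₂ (ly , hy) rewrite lx | hx | ly | hy = Separates-swapʳ ⇔-∘ Separates-swapˡ

    ¬crossing-self : ∀ {x} → ¬ CrossOf lo hi x x
    ¬crossing-self (inj₁ (lo<lo , _)) = <-irrefl refl lo<lo
    ¬crossing-self (inj₂ (lo<lo , _)) = <-irrefl refl lo<lo

    crossing-sym : ∀ {x y} → CrossOf lo hi x y → CrossOf lo hi y x
    crossing-sym (inj₁ cr) = inj₂ cr
    crossing-sym (inj₂ cr) = inj₁ cr

  circleRep : (G : Graph V) → EndsRepresent G → CircleRep G
  circleRep G adj⇔ = record
    { l = lo ; r = hi ; l<r = lo<hi ; endpoint-inj = lohi-inj ; represents = adj⇔crossing }
    where
    adj⇔CrossOf : ∀ {x y} → adj G x y ⇔ SeparatesEnds x y → adj G x y ⇔ CrossOf lo hi x y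
    adj⇔CrossOf {x} {y} adj⇔sep =
      ⇔-sym (CrossOf⇔Separates lo hi (lo<hi x) (lo<hi y)) ⇔-∘ (⇔-sym (Separates-lohi x y) ⇔-∘ adj⇔sep)
    adj⇔crossing : ∀ x y → adj G x y ⇔ CrossOf lo hi x y
    adj⇔crossing x y with x ≟ y
    ... | yes refl = mk⇔ (⊥-elim ∘ irrefl G) (⊥-elim ∘ ¬crossing-self)
    ... | no x≢y with adj⇔ x y x≢y
    ...   | inj₁ adj⇔sep = adj⇔CrossOf adj⇔sep
    ...   | inj₂ adj⇔sep =
      mk⇔ crossing-sym crossing-sym ⇔-∘ (adj⇔CrossOf adj⇔sep ⇔-∘ mk⇔ (Graph.sym G) (Graph.sym G))

  polygonRep : (G : Graph V) → EndsRepresent G →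
    ∀ {k} → 2 ≤ k → (corner : Fin k → ℕ) → (∀ i j → corner i ≡ corner j → i ≡ j) →
    (∀ i x b → corner i ≢ end x b) →
    (∀ x b → ∃ λ i → InArc (end x b) (end x (not b)) (corner i)) →
    PolygonRep G k
  polygonRep G adj⇔ 2≤k corner corner-inj corner≢end between = record
    { 2≤k = 2≤k
    ; circ = circleRep G adj⇔
    ; corner = corner
    ; corner-inj = corner-inj
    ; corner≢endpoint = λ i x b eq → corner≢end i x (proj₁ (is-end x b)) (trans eq (proj₂ (is-end x b)))
    ; inner-corner = inner
    ; outer-corner = outer
    }
    where
    inner : ∀ x → ∃ λ i → InArc (lo x) (hi x) (corner i)
    inner x with orientation x
    ... | inj₁ (lx , hx) rewrite lx | hx = between x true
    ... | inj₂ (lx , hx) rewrite lx | hx = between x false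
    outer : ∀ x → ∃ λ i → InArc (hi x) (lo x) (corner i)
    outer x with orientation x
    ... | inj₁ (lx , hx) rewrite lx | hx = between x false
    ... | inj₂ (lx , hx) rewrite lx | hx = between x true

-- A map increasing below and above the cut k, sending the part above the cut below the part
-- under it, rotates the circle.
module Shift (D : ℕ → Set) (k : ℕ) (f : ℕ → ℕ)
  (mono-below : ∀ {x y} → D x → D y → x < y → y < k → f x < f y)
  (mono-above : ∀ {x y} → D x → D y → k ≤ x → x < y → f x < f y)
  (wrap : ∀ {x y} → D x → D y → x < k → k ≤ y → f y < f x) where

  private
    ordered : ∀ {x y z} → D x → D y → D z → x < y → y < z → InArc (f x) (f z) (f y)
    ordered {x} {y} {z} dx dy dz x<y y<z with z <? k | y <? k | x <? k
    ... | yes z<k | _ | _ =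
      inj₁ (mono-below dx dy x<y (<-trans y<z z<k) , mono-below dy dz y<z z<k)
    ... | no z≮k | yes y<k | _ =
      inj₂ (wrap dx dz (<-trans x<y y<k) (≮⇒≥ z≮k) , inj₁ (mono-below dx dy x<y y<k))
    ... | no _ | no y≮k | yes x<k =
      inj₂ (wrap dx dz x<k (≤-trans (≮⇒≥ y≮k) (<⇒≤ y<z)) , inj₂ (mono-above dy dz (≮⇒≥ y≮k) y<z))
    ... | no _ | no _ | no x≮k =
      inj₁ (mono-above dx dy (≮⇒≥ x≮k) x<y , mono-above dy dz (≤-trans (≮⇒≥ x≮k) (<⇒≤ x<y)) y<z)

    apart : ∀ {x y} → D x → D y → x < y → f x ≢ f y
    apart {x} {y} dx dy x<y with y <? k | x <? k
    ... | yes y<k | _      = <⇒≢ (mono-below dx dy x<y y<k)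
    ... | no y≮k | yes x<k = >⇒≢ (wrap dx dy x<k (≮⇒≥ y≮k))
    ... | no _ | no x≮k    = <⇒≢ (mono-above dx dy (≮⇒≥ x≮k) x<y)

  injective : ∀ {x y} → D x → D y → f x ≡ f y → x ≡ y
  injective {x} {y} dx dy fx≡fy with <-cmp x y
  ... | tri< x<y _ _ = ⊥-elim (apart dx dy x<y fx≡fy)
  ... | tri≈ _ x≡y _ = x≡y
  ... | tri> _ _ y<x = ⊥-elim (apart dy dx y<x (≡-sym fx≡fy))

  preserves-InArc : D a → D b → D c → InArc a b c → InArc (f a) (f b) (f c)
  preserves-InArc da db dc (inj₁ (a<c , c<b))       = ordered da dc db a<c c<b
  preserves-InArc da db dc (inj₂ (b<a , inj₁ a<c)) = InArc-rotate (ordered db da dc b<a a<c)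
  preserves-InArc da db dc (inj₂ (b<a , inj₂ c<b)) = InArc-rotate (InArc-rotate (ordered dc db da c<b b<a))

  InArc-⇔ : D a → D b → D c → a ≢ b → a ≢ c → b ≢ c → InArc (f a) (f b) (f c) ⇔ InArc a b c
  InArc-⇔ da db dc a≢b a≢c b≢c = mk⇔ reflect (preserves-InArc da db dc)
    where
    reflect : InArc (f _) (f _) (f _) → InArc _ _ _
    reflect fa→fc→fb with InArc-total a≢b a≢c b≢c
    ... | inj₁ a→c→b = a→c→b
    ... | inj₂ b→c→a = ⊥-elim (InArc-asym fa→fc→fb (preserves-InArc db da dc b→c→a))

  Separates-⇔ : ∀ {V : Set} (e : V → Bool → ℕ) → EndpointInjective e → ∀ {x y} → x ≢ y →
    (∀ b → D (e x b)) → (∀ b → D (e y b)) →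
    Separates (f (e x true)) (f (e x false)) (f (e y true)) (f (e y false)) ⇔
    Separates (e x true) (e x false) (e y true) (e y false)
  Separates-⇔ e e-inj {x} {y} x≢y dx dy =
    Separates-cong (arc true true) (arc false false) (arc false true) (arc true false)
    where
    arc : ∀ b c → InArc (f (e x b)) (f (e x (not b))) (f (e y c)) ⇔ InArc (e x b) (e x (not b)) (e y c)
    arc b c = InArc-⇔ (dx b) (dx (not b)) (dy c)
      (λ eq → not-¬ refl (proj₂ (e-inj x x b (not b) eq)))
      (λ eq → x≢y (proj₁ (e-inj x y b c eq)))
      (λ eq → x≢y (proj₁ (e-inj x y (not b) c eq)))

c*M+o<d*M : ∀ M {c d o} → c < d → o < M → c * M + o < d * M
c*M+o<d*M M {c} {d} {o} c<d o<M = begin-strict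
  c * M + o  <⟨ +-monoʳ-< (c * M) o<M ⟩
  c * M + M  ≡⟨ +-comm (c * M) M ⟩
  suc c * M  ≤⟨ *-monoˡ-≤ M c<d ⟩
  d * M      ∎
  where open ≤-Reasoning

c*M+o<d*M+o′ : ∀ M {c d o} o′ → c < d → o < M → c * M + o < d * M + o′
c*M+o<d*M+o′ M o′ c<d o<M = <-≤-trans (c*M+o<d*M M c<d o<M) (m≤m+n _ o′)

module _ (M : ℕ) .{{_ : NonZero M}} where

  x*M<c*M+o⇔x<c : ∀ {x c o} → x ≢ c → o < M → x * M < c * M + o ⇔ x < c
  x*M<c*M+o⇔x<c {x} {c} {o} x≢c o<M = mk⇔ bound (λ x<c → <-≤-trans (*-monoˡ-< M x<c) (m≤m+n _ o))
    where
    bound : x * M < c * M + o → x < c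
    bound xM<cM+o with <-cmp x c
    ... | tri< x<c _ _ = x<c
    ... | tri≈ _ x≡c _ = contradiction x≡c x≢c
    ... | tri> _ _ c<x = contradiction (c*M+o<d*M M c<x o<M) (<-asym xM<cM+o)

  c*M+o<x*M⇔c<x : ∀ {x c o} → x ≢ c → o < M → c * M + o < x * M ⇔ c < x
  c*M+o<x*M⇔c<x {x} {c} {o} x≢c o<M = mk⇔ bound (λ c<x → c*M+o<d*M M c<x o<M)
    where
    bound : c * M + o < x * M → c < x
    bound cM+o<xM with <-cmp c x
    ... | tri< c<x _ _ = c<x
    ... | tri≈ _ c≡x _ = contradiction (≡-sym c≡x) x≢c
    ... | tri> _ _ x<c = contradiction (<-≤-trans (*-monoˡ-< M x<c) (m≤m+n _ o)) (<-asym cM+o<xM)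

  x*M≢c*M+o : ∀ {x c o} → 0 < o → o < M → x * M ≢ c * M + o
  x*M≢c*M+o {x} {c} {o} 0<o o<M eq with <-cmp x c
  ... | tri< x<c _ _ = <-irrefl eq (<-≤-trans (*-monoˡ-< M x<c) (m≤m+n _ _))
  ... | tri≈ _ refl _ = <-irrefl eq (m<m+n _ 0<o)
  ... | tri> _ _ c<x = <-irrefl (≡-sym eq) (c*M+o<d*M M c<x o<M)

  InArc-blocks : ∀ {x y c o} → x ≢ c → y ≢ c → o < M →
                 InArc (x * M) (y * M) (c * M + o) ⇔ InArc x y c
  InArc-blocks {x} {y} x≢c y≢c o<M = InArc-cong-< (x*M<c*M+o⇔x<c x≢c o<M) (c*M+o<x*M⇔c<x y≢c o<M)
    (mk⇔ (*-cancelʳ-< M y x) (*-monoˡ-< M))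

enumerate : ∀ {k} (p : Subset k) → Fin ∣ p ∣ → Fin k
enumerate (true ∷ p) Fin.zero    = Fin.zero
enumerate (true ∷ p) (Fin.suc j) = Fin.suc (enumerate p j)
enumerate (false ∷ p) j          = Fin.suc (enumerate p j)

enumerate-injective : ∀ {k} (p : Subset k) {i j} → enumerate p i ≡ enumerate p j → i ≡ j
enumerate-injective (true ∷ p) {Fin.zero} {Fin.zero} _    = refl
enumerate-injective (true ∷ p) {Fin.suc i} {Fin.suc j} eq =
  cong Fin.suc (enumerate-injective p (Finₚ.suc-injective eq))
enumerate-injective (false ∷ p) eq = enumerate-injective p (Finₚ.suc-injective eq)

enumerate-onto : ∀ {k} (p : Subset k) {i} → i ∈ p → ∃ λ j → enumerate p j ≡ i
enumerate-onto (true ∷ p) here = Fin.zero , refl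
enumerate-onto (true ∷ p) (there i∈p) with enumerate-onto p i∈p
... | j , refl = Fin.suc j , refl
enumerate-onto (false ∷ p) (there i∈p) with enumerate-onto p i∈p
... | j , refl = j , refl

bounded : ∀ {m} (f : Fin m → ℕ) → ∃ λ N → ∀ i → f i < N
bounded {zero} f = 0 , λ ()
bounded {suc m} f with bounded (f ∘ Fin.suc)
... | N , f<N = suc (f Fin.zero) ⊔ N , λ { Fin.zero → m≤m⊔n _ N ; (Fin.suc i) → <-≤-trans (f<N i) (m≤n⊔m _ N) }

module _ {V : Set} {H : Graph V} {k} (P : PolygonRep H k) where

  private
    C = circ P

  close-endpoint-between : ∀ {x y i b c} → x ≢ y →
    InArc (endpoint C x b) (endpoint C x (not b)) (corner P i) →
    EndpointClose P (endpoint C y c) i →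
    InArc (endpoint C x b) (endpoint C x (not b)) (endpoint C y c)
  close-endpoint-between {x} {y} {i} {b} {c} x≢y between (inj₁ (_ , _ , _ , none)) =
    InArc-unobstructed⁺ between (endpoint-≢ C (x≢y ∘ ≡-sym) c b) (endpoint-≢ C (x≢y ∘ ≡-sym) c (not b))
      (corner≢endpoint P i x b) (corner≢endpoint P i x (not b)) (corner≢endpoint P i y c)
      (none x b) (none x (not b))
  close-endpoint-between {x} {y} {i} {b} {c} x≢y between (inj₂ (_ , _ , _ , none)) =
    InArc-unobstructed⁻ between (endpoint-≢ C (x≢y ∘ ≡-sym) c b) (endpoint-≢ C (x≢y ∘ ≡-sym) c (not b))
      (corner≢endpoint P i x b) (corner≢endpoint P i x (not b)) (corner≢endpoint P i y c)
      (none x b) (none x (not b))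

  close-chord-between : ∀ {x y i b} → x ≢ y →
    InArc (endpoint C x b) (endpoint C x (not b)) (corner P i) → ChordClose P y i →
    InArc (endpoint C x b) (endpoint C x (not b)) (l C y) ⊎
    InArc (endpoint C x b) (endpoint C x (not b)) (r C y)
  close-chord-between {b = b} x≢y between (inj₁ close) =
    inj₁ (close-endpoint-between {b = b} {c = true} x≢y between close)
  close-chord-between {b = b} x≢y between (inj₂ close) =
    inj₂ (close-endpoint-between {b = b} {c = false} x≢y between close)

  corner-between : ∀ x b → ∃ λ i → InArc (endpoint C x b) (endpoint C x (not b)) (corner P i)
  corner-between x true  = inner-corner P x
  corner-between x false = outer-corner P x

module ⇔-Reasoning = SetoidReasoning (⇔-setoid 0ℓ)

module Glue {n} (G : Graph (Fin n)) (s : Fin n → Bool) (split : IsSplit G s)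
  {k₁ k₂} (P₁ : PolygonRep (G₁ G s) k₁) (P₂ : PolygonRep (G₂ G s) k₂)
  (S : Subset k₁) (S-close : ∀ i → i ∈ S → ChordClose P₁ marker i) where

  C₁ : CircleRep (G₁ G s)
  C₁ = circ P₁
  C₂ : CircleRep (G₂ G s)
  C₂ = circ P₂

  a₁ b₁ a₂ b₂ : ℕ
  a₁ = l C₁ marker
  b₁ = r C₁ marker
  a₂ = l C₂ marker
  b₂ = r C₂ marker

  a₁<b₁ : a₁ < b₁
  a₁<b₁ = l<r C₁ marker
  a₂<b₂ : a₂ < b₂
  a₂<b₂ = l<r C₂ marker

  right₂ : Fin n → ℕ
  right₂ x with s x Bool.≟ false
  ... | yes e = r C₂ (inj₁ (x , e))
  ... | no _  = 0

  right₂-≥ : ∀ x (e : s x ≡ false) → r C₂ (inj₁ (x , e)) ≤ right₂ x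
  right₂-≥ x e with s x Bool.≟ false
  ... | yes e′ = ≤-reflexive (cong (λ e → r C₂ (inj₁ (x , e))) (Decidable⇒UIP.≡-irrelevant Bool._≟_ e e′))
  ... | no s≢f = contradiction e s≢f

  N M : ℕ
  N = proj₁ (bounded right₂) ⊔ proj₁ (bounded (corner P₂))
  M = suc (N + N)

  Valid : ℕ → Set
  Valid t = t ≢ a₂ × t ≢ b₂ × t < N

  valid-endpoint : ∀ (y : Part s false) c → Valid (endpoint C₂ (inj₁ y) c)
  valid-endpoint y@(x , e) c = endpoint-≢ C₂ (λ ()) c true , endpoint-≢ C₂ (λ ()) c false , (begin-strict
    endpoint C₂ (inj₁ y) c  ≤⟨ ≤r c ⟩
    r C₂ (inj₁ y)           ≤⟨ right₂-≥ x e ⟩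
    right₂ x                <⟨ proj₂ (bounded right₂) x ⟩
    proj₁ (bounded right₂)  ≤⟨ m≤m⊔n _ _ ⟩
    N                       ∎)
    where
    open ≤-Reasoning
    ≤r : ∀ c → endpoint C₂ (inj₁ y) c ≤ r C₂ (inj₁ y)
    ≤r true  = <⇒≤ (l<r C₂ (inj₁ y))
    ≤r false = ≤-refl

  valid-corner : ∀ j → Valid (corner P₂ j)
  valid-corner j = corner≢endpoint P₂ j marker true , corner≢endpoint P₂ j marker false
                 , <-≤-trans (proj₂ (bounded (corner P₂)) j) (m≤n⊔m _ _)

  valid<M : ∀ {t} → Valid t → t < M
  valid<M (_ , _ , t<N) = <-trans t<N (s≤s (m≤m+n N N))

  -- A position t of P₂ is placed at offset (offset t) in the block following position
  -- (block t) of P₁, blocks being M apart: the arc from a₂ to b₂ goes next to a₁, and the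
  -- rest of the circle of P₂, cut open at a₂, goes next to b₁.
  block offset : ℕ → ℕ
  block t with t <? a₂ | t <? b₂
  ... | no _ | yes _ = a₁
  ... | _    | _     = b₁
  offset t with t <? a₂
  ... | yes _ = N + t
  ... | no _  = t

  φ ψ : ℕ → ℕ
  φ x = x * M
  ψ t = block t * M + offset t

  block-inside : ∀ {t} → InArc a₂ b₂ t → block t ≡ a₁
  block-inside {t} t∈ with t <? a₂ | t <? b₂ | t∈
  ... | no _     | yes _    | _ = refl
  ... | yes t<a₂ | _        | inj₁ (a₂<t , _) = contradiction t<a₂ (<-asym a₂<t)
  ... | _        | no t≮b₂  | inj₁ (_ , t<b₂) = contradiction t<b₂ t≮b₂
  ... | _        | _        | inj₂ (b₂<a₂ , _) = contradiction b₂<a₂ (<-asym a₂<b₂)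

  block-outside : ∀ {t} → InArc b₂ a₂ t → block t ≡ b₁
  block-outside {t} t∈ with t <? a₂ | t <? b₂ | t∈
  ... | yes _    | _        | _ = refl
  ... | no _     | no _     | _ = refl
  ... | no t≮a₂  | yes _    | inj₁ (_ , t<a₂) = contradiction t<a₂ t≮a₂
  ... | no _     | yes t<b₂ | inj₂ (_ , inj₁ b₂<t) = contradiction t<b₂ (<-asym b₂<t)
  ... | no t≮a₂  | yes _    | inj₂ (_ , inj₂ t<a₂) = contradiction t<a₂ t≮a₂

  offset-before : ∀ {t} → t < a₂ → offset t ≡ N + t
  offset-before {t} t<a₂ with t <? a₂
  ... | yes _    = refl
  ... | no t≮a₂  = contradiction t<a₂ t≮a₂

  offset-not-before : ∀ {t} → ¬ t < a₂ → offset t ≡ t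
  offset-not-before {t} t≮a₂ with t <? a₂
  ... | yes t<a₂ = contradiction t<a₂ t≮a₂
  ... | no _     = refl

  data Region (t : ℕ) : Set where
    before : t < a₂ → Region t
    inside : a₂ < t → t < b₂ → Region t
    after  : b₂ < t → Region t

  region : ∀ {t} → Valid t → Region t
  region {t} (t≢a₂ , t≢b₂ , _) with <-cmp t a₂ | <-cmp t b₂
  ... | tri< t<a₂ _ _ | _             = before t<a₂
  ... | tri≈ _ t≡a₂ _ | _             = contradiction t≡a₂ t≢a₂
  ... | tri> _ _ a₂<t | tri< t<b₂ _ _ = inside a₂<t t<b₂
  ... | tri> _ _ _    | tri≈ _ t≡b₂ _ = contradiction t≡b₂ t≢b₂
  ... | tri> _ _ _    | tri> _ _ b₂<t = after b₂<t

  ψ-before : ∀ {t} → t < a₂ → ψ t ≡ b₁ * M + (N + t)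
  ψ-before t<a₂ =
    cong₂ (λ c o → c * M + o) (block-outside (inj₂ (a₂<b₂ , inj₂ t<a₂))) (offset-before t<a₂)

  ψ-inside : ∀ {t} → a₂ < t → t < b₂ → ψ t ≡ a₁ * M + t
  ψ-inside a₂<t t<b₂ =
    cong₂ (λ c o → c * M + o) (block-inside (inj₁ (a₂<t , t<b₂))) (offset-not-before (<-asym a₂<t))

  ψ-after : ∀ {t} → b₂ < t → ψ t ≡ b₁ * M + t
  ψ-after b₂<t = cong₂ (λ c o → c * M + o) (block-outside (inj₂ (a₂<b₂ , inj₁ b₂<t)))
                   (offset-not-before (<-asym (<-trans a₂<b₂ b₂<t)))

  offset-bounds : ∀ {t} → Valid t → 0 < offset t × offset t < M
  offset-bounds v@(_ , _ , t<N) with region v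
  ... | before t<a₂ rewrite offset-before t<a₂ =
    <-≤-trans (≤-<-trans z≤n t<N) (m≤m+n N _) , s≤s (+-monoʳ-≤ N (<⇒≤ t<N))
  ... | inside a₂<t _ rewrite offset-not-before (<-asym a₂<t) = ≤-<-trans z≤n a₂<t , valid<M v
  ... | after b₂<t rewrite offset-not-before (<-asym (<-trans a₂<b₂ b₂<t)) =
    ≤-<-trans z≤n b₂<t , valid<M v

  -- φ is increasing, i.e. a shift with cut 0.
  module Φ = Shift (λ _ → ⊤) 0 φ (λ _ _ _ ()) (λ _ _ _ → *-monoˡ-< M) (λ _ _ ())

  module _ where
    open ≤-Reasoning

    ψ-mono-below : ∀ {x y} → Valid x → Valid y → x < y → y < a₂ → ψ x < ψ y
    ψ-mono-below {x} {y} _ _ x<y y<a₂ = begin-strict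
      ψ x              ≡⟨ ψ-before (<-trans x<y y<a₂) ⟩
      b₁ * M + (N + x) <⟨ +-monoʳ-< (b₁ * M) (+-monoʳ-< N x<y) ⟩
      b₁ * M + (N + y) ≡⟨ ψ-before y<a₂ ⟨
      ψ y              ∎
    ψ-mono-above : ∀ {x y} → Valid x → Valid y → a₂ ≤ x → x < y → ψ x < ψ y
    ψ-mono-above {x} {y} vx vy a₂≤x x<y with region vx | region vy
    ... | before x<a₂ | _ = contradiction a₂≤x (<⇒≱ x<a₂)
    ... | _ | before y<a₂ = contradiction (≤-<-trans a₂≤x x<y) (<-asym y<a₂)
    ... | after b₂<x | inside _ y<b₂ = contradiction (<-trans b₂<x x<y) (<-asym y<b₂)
    ... | inside a₂<x x<b₂ | inside a₂<y y<b₂ = begin-strict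
      ψ x        ≡⟨ ψ-inside a₂<x x<b₂ ⟩
      a₁ * M + x <⟨ +-monoʳ-< (a₁ * M) x<y ⟩
      a₁ * M + y ≡⟨ ψ-inside a₂<y y<b₂ ⟨
      ψ y        ∎
    ... | inside a₂<x x<b₂ | after b₂<y = begin-strict
      ψ x        ≡⟨ ψ-inside a₂<x x<b₂ ⟩
      a₁ * M + x <⟨ c*M+o<d*M+o′ M y a₁<b₁ (valid<M vx) ⟩
      b₁ * M + y ≡⟨ ψ-after b₂<y ⟨
      ψ y        ∎
    ... | after b₂<x | after b₂<y = begin-strict
      ψ x        ≡⟨ ψ-after b₂<x ⟩
      b₁ * M + x <⟨ +-monoʳ-< (b₁ * M) x<y ⟩
      b₁ * M + y ≡⟨ ψ-after b₂<y ⟨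
      ψ y        ∎
    ψ-wrap : ∀ {x y} → Valid x → Valid y → x < a₂ → a₂ ≤ y → ψ y < ψ x
    ψ-wrap {x} {y} _ vy@(_ , _ , y<N) x<a₂ a₂≤y with region vy
    ... | before y<a₂ = contradiction a₂≤y (<⇒≱ y<a₂)
    ... | inside a₂<y y<b₂ = begin-strict
      ψ y              ≡⟨ ψ-inside a₂<y y<b₂ ⟩
      a₁ * M + y       <⟨ c*M+o<d*M+o′ M (N + x) a₁<b₁ (valid<M vy) ⟩
      b₁ * M + (N + x) ≡⟨ ψ-before x<a₂ ⟨
      ψ x              ∎
    ... | after b₂<y = begin-strict
      ψ y              ≡⟨ ψ-after b₂<y ⟩
      b₁ * M + y       <⟨ +-monoʳ-< (b₁ * M) (<-≤-trans y<N (m≤m+n N x)) ⟩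
      b₁ * M + (N + x) ≡⟨ ψ-before x<a₂ ⟨
      ψ x              ∎

  module Ψ = Shift Valid a₂ ψ ψ-mono-below ψ-mono-above ψ-wrap

  φ≢ψ : ∀ x {t} → Valid t → φ x ≢ ψ t
  φ≢ψ x {t} v = x*M≢c*M+o M {x} {block t} (proj₁ (offset-bounds v)) (proj₂ (offset-bounds v))

  InArc-φφψ : ∀ {x y t c} → block t ≡ c → x ≢ c → y ≢ c → Valid t →
              InArc (φ x) (φ y) (ψ t) ⇔ InArc x y c
  InArc-φφψ refl x≢c y≢c v = InArc-blocks M x≢c y≢c (proj₂ (offset-bounds v))

  Separates-φψ-blocks : ∀ {u w t₀ t₁ c₀ c₁} → Valid t₀ → Valid t₁ → block t₀ ≡ c₀ → block t₁ ≡ c₁ →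
    u ≢ c₀ → w ≢ c₀ → u ≢ c₁ → w ≢ c₁ → Separates (φ u) (φ w) (ψ t₀) (ψ t₁) ⇔ Separates u w c₀ c₁
  Separates-φψ-blocks v₀ v₁ β₀ β₁ u≢c₀ w≢c₀ u≢c₁ w≢c₁ = Separates-cong
    (InArc-φφψ β₀ u≢c₀ w≢c₀ v₀) (InArc-φφψ β₁ w≢c₁ u≢c₁ v₁)
    (InArc-φφψ β₀ w≢c₀ u≢c₀ v₀) (InArc-φφψ β₁ u≢c₁ w≢c₁ v₁)

  side : ∀ {t} → Valid t → InArc a₂ b₂ t ⊎ InArc b₂ a₂ t
  side (t≢a₂ , t≢b₂ , _) = InArc-total (<⇒≢ a₂<b₂) (≢-sym t≢a₂) (≢-sym t≢b₂)

  Separates-φψ : ∀ {u w t₀ t₁} → u ≢ a₁ → u ≢ b₁ → w ≢ a₁ → w ≢ b₁ → Valid t₀ → Valid t₁ →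
    Separates (φ u) (φ w) (ψ t₀) (ψ t₁) ⇔ (Separates u w a₁ b₁ × Separates a₂ b₂ t₀ t₁)
  Separates-φψ {u} {w} {t₀} {t₁} u≢a₁ u≢b₁ w≢a₁ w≢b₁ v₀ v₁ = by-sides (side v₀) (side v₁)
    where
    blocks : ∀ {c₀ c₁} → block t₀ ≡ c₀ → block t₁ ≡ c₁ → u ≢ c₀ → w ≢ c₀ → u ≢ c₁ → w ≢ c₁ →
             Separates (φ u) (φ w) (ψ t₀) (ψ t₁) ⇔ Separates u w c₀ c₁
    blocks = Separates-φψ-blocks v₀ v₁
    by-sides : InArc a₂ b₂ t₀ ⊎ InArc b₂ a₂ t₀ → InArc a₂ b₂ t₁ ⊎ InArc b₂ a₂ t₁ →
      Separates (φ u) (φ w) (ψ t₀) (ψ t₁) ⇔ (Separates u w a₁ b₁ × Separates a₂ b₂ t₀ t₁)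
    by-sides (inj₁ in₀) (inj₁ in₁) =
      mk⇔ (⊥-elim ∘ ¬Separates-point ∘ to (blocks (block-inside in₀) (block-inside in₁) u≢a₁ w≢a₁ u≢a₁ w≢a₁))
          (⊥-elim ∘ ¬Separates-sameArc in₀ in₁ ∘ proj₂)
    by-sides (inj₁ in₀) (inj₂ out₁) =
      mk⇔ (λ sep → sep , inj₁ (in₀ , out₁)) proj₁
        ⇔-∘ blocks (block-inside in₀) (block-outside out₁) u≢a₁ w≢a₁ u≢b₁ w≢b₁
    by-sides (inj₂ out₀) (inj₁ in₁) =
      mk⇔ (λ sep → to Separates-swapʳ sep , inj₂ (out₀ , in₁)) (from Separates-swapʳ ∘ proj₁)
        ⇔-∘ blocks (block-outside out₀) (block-inside in₁) u≢b₁ w≢b₁ u≢a₁ w≢a₁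
    by-sides (inj₂ out₀) (inj₂ out₁) =
      mk⇔ (⊥-elim ∘ ¬Separates-point ∘ to (blocks (block-outside out₀) (block-outside out₁) u≢b₁ w≢b₁ u≢b₁ w≢b₁))
          (⊥-elim ∘ ¬Separates-sameArc out₀ out₁ ∘ to Separates-swapˡ ∘ proj₂)

  place : (β : Bool) → Part s β → Bool → ℕ
  place true  x = φ ∘ endpoint C₁ (inj₁ x)
  place false y = ψ ∘ endpoint C₂ (inj₁ y)

  place-injective : ∀ β γ (x : Part s β) (y : Part s γ) c d →
    place β x c ≡ place γ y d → proj₁ x ≡ proj₁ y × c ≡ d
  place-injective true true x y c d eq
    with endpoint-inj C₁ (inj₁ x) (inj₁ y) c d (Φ.injective tt tt eq)
  ... | refl , c≡d = refl , c≡d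
  place-injective false false x y c d eq
    with endpoint-inj C₂ (inj₁ x) (inj₁ y) c d (Ψ.injective (valid-endpoint x c) (valid-endpoint y d) eq)
  ... | refl , c≡d = refl , c≡d
  place-injective true false x y c d eq = ⊥-elim (φ≢ψ (endpoint C₁ (inj₁ x) c) (valid-endpoint y d) eq)
  place-injective false true x y c d eq = ⊥-elim (φ≢ψ (endpoint C₁ (inj₁ y) d) (valid-endpoint x c) (≡-sym eq))

  endpoint≢marker₁ : ∀ (x : Part s true) c d → endpoint C₁ (inj₁ x) c ≢ endpoint C₁ marker d
  endpoint≢marker₁ x = endpoint-≢ C₁ (λ ())

  SeparatesPlaced : ∀ β γ → Part s β → Part s γ → Set
  SeparatesPlaced β γ x y = Separates (place β x true) (place β x false) (place γ y true) (place γ y false)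

  inj₁-≢ : ∀ {β} {x y : Part s β} → proj₁ x ≢ proj₁ y → inj₁ {B = ⊤} x ≢ inj₁ y
  inj₁-≢ x≢y = x≢y ∘ cong proj₁ ∘ inj₁-injective

  adj⇔Separates₁ : ∀ (x y : Part s true) → proj₁ x ≢ proj₁ y →
    adj G (proj₁ x) (proj₁ y) ⇔ SeparatesPlaced true true x y
  adj⇔Separates₁ x y x≢y =
    ⇔-sym (Φ.Separates-⇔ (endpoint C₁) (endpoint-inj C₁) (inj₁-≢ x≢y) (λ _ → tt) (λ _ → tt))
      ⇔-∘ adj⇔Separates C₁ (inj₁ x) (inj₁ y)

  adj⇔Separates₂ : ∀ (x y : Part s false) → proj₁ x ≢ proj₁ y →
    adj G (proj₁ x) (proj₁ y) ⇔ SeparatesPlaced false false x y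
  adj⇔Separates₂ x y x≢y =
    ⇔-sym (Ψ.Separates-⇔ (endpoint C₂) (endpoint-inj C₂) (inj₁-≢ x≢y) (valid-endpoint x) (valid-endpoint y))
      ⇔-∘ adj⇔Separates C₂ (inj₁ x) (inj₁ y)

  -- By the split property, x ∈ V₁ and y ∈ V₂ are adjacent iff both chords cross the marker chord.
  adj⇔Separates₁₂ : ∀ (x : Part s true) (y : Part s false) →
    adj G (proj₁ x) (proj₁ y) ⇔ SeparatesPlaced true false x y
  adj⇔Separates₁₂ x y = begin
    adj G (proj₁ x) (proj₁ y)
      ≈⟨ IsSplit.cross-edges split (proj₁ x) (proj₁ y) (proj₂ x) (proj₂ y) ⟩
    (adj (G₁ G s) (inj₁ x) marker × adj (G₂ G s) marker (inj₁ y))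
      ≈⟨ adj⇔Separates C₁ (inj₁ x) marker ×-⇔ adj⇔Separates C₂ marker (inj₁ y) ⟩
    (Separates lx rx a₁ b₁ × Separates a₂ b₂ (endpoint C₂ (inj₁ y) true) (endpoint C₂ (inj₁ y) false))
      ≈⟨ Separates-φψ (≢ₘ true true) (≢ₘ true false) (≢ₘ false true) (≢ₘ false false)
                      (valid-endpoint y true) (valid-endpoint y false) ⟨
    SeparatesPlaced true false x y ∎
    where
    open ⇔-Reasoning
    lx rx : ℕ
    lx = endpoint C₁ (inj₁ x) true
    rx = endpoint C₁ (inj₁ x) false
    ≢ₘ : ∀ c d → endpoint C₁ (inj₁ x) c ≢ endpoint C₁ marker d
    ≢ₘ = endpoint≢marker₁ x

  adj-place : ∀ β γ (x : Part s β) (y : Part s γ) → proj₁ x ≢ proj₁ y →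
    (adj G (proj₁ x) (proj₁ y) ⇔ SeparatesPlaced β γ x y) ⊎
    (adj G (proj₁ y) (proj₁ x) ⇔ SeparatesPlaced γ β y x)
  adj-place true  true  x y x≢y = inj₁ (adj⇔Separates₁ x y x≢y)
  adj-place false false x y x≢y = inj₁ (adj⇔Separates₂ x y x≢y)
  adj-place true  false x y _   = inj₁ (adj⇔Separates₁₂ x y)
  adj-place false true  x y _   = inj₂ (adj⇔Separates₁₂ y x)

  corner⊎ : Fin ∣ ∁ S ∣ ⊎ Fin k₂ → ℕ
  corner⊎ (inj₁ j) = φ (corner P₁ (enumerate (∁ S) j))
  corner⊎ (inj₂ j) = ψ (corner P₂ j)

  corner⊎-injective : ∀ u v → corner⊎ u ≡ corner⊎ v → u ≡ v
  corner⊎-injective (inj₁ i) (inj₁ j) eq =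
    cong inj₁ (enumerate-injective (∁ S) (corner-inj P₁ _ _ (Φ.injective tt tt eq)))
  corner⊎-injective (inj₂ i) (inj₂ j) eq =
    cong inj₂ (corner-inj P₂ _ _ (Ψ.injective (valid-corner i) (valid-corner j) eq))
  corner⊎-injective (inj₁ i) (inj₂ j) eq = ⊥-elim (φ≢ψ (corner P₁ (enumerate (∁ S) i)) (valid-corner j) eq)
  corner⊎-injective (inj₂ i) (inj₁ j) eq = ⊥-elim (φ≢ψ (corner P₁ (enumerate (∁ S) j)) (valid-corner i) (≡-sym eq))

  corner⊎≢place : ∀ u β (x : Part s β) c → corner⊎ u ≢ place β x c
  corner⊎≢place (inj₁ i) true  x c eq = corner≢endpoint P₁ _ (inj₁ x) c (Φ.injective tt tt eq)
  corner⊎≢place (inj₁ i) false y c eq = φ≢ψ (corner P₁ (enumerate (∁ S) i)) (valid-endpoint y c) eq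
  corner⊎≢place (inj₂ j) true  x c eq = φ≢ψ (endpoint C₁ (inj₁ x) c) (valid-corner j) (≡-sym eq)
  corner⊎≢place (inj₂ j) false y c eq =
    corner≢endpoint P₂ j (inj₁ y) c (Ψ.injective (valid-corner j) (valid-endpoint y c) eq)

  -- The corners of P₂ on either side of its marker chord sit next to a₁ and b₁ respectively.
  corner-near-marker : ∀ (x : Part s true) c →
    InArc (endpoint C₁ (inj₁ x) c) (endpoint C₁ (inj₁ x) (not c)) a₁ ⊎
    InArc (endpoint C₁ (inj₁ x) c) (endpoint C₁ (inj₁ x) (not c)) b₁ →
    ∃ λ u → InArc (place true x c) (place true x (not c)) (corner⊎ u)
  corner-near-marker x c (inj₁ a₁∈) with inner-corner P₂ marker
  ... | j , cj∈ = inj₂ j , from (InArc-φφψ (block-inside cj∈)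
    (endpoint≢marker₁ x c true) (endpoint≢marker₁ x (not c) true) (valid-corner j)) a₁∈
  corner-near-marker x c (inj₂ b₁∈) with outer-corner P₂ marker
  ... | j , cj∈ = inj₂ j , from (InArc-φφψ (block-outside cj∈)
    (endpoint≢marker₁ x c false) (endpoint≢marker₁ x (not c) false) (valid-corner j)) b₁∈

  corner⊎-between : ∀ β (x : Part s β) c → ∃ λ u → InArc (place β x c) (place β x (not c)) (corner⊎ u)
  corner⊎-between false y c with corner-between P₂ (inj₁ y) c
  ... | j , between =
    inj₂ j , Ψ.preserves-InArc (valid-endpoint y c) (valid-endpoint y (not c)) (valid-corner j) between
  corner⊎-between true x c with corner-between P₁ (inj₁ x) c
  ... | i , between with i ∈? S
  ...   | yes i∈S =
    corner-near-marker x c (close-chord-between P₁ {inj₁ x} {b = c} (λ ()) between (S-close i i∈S))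
  ...   | no i∉S with enumerate-onto (∁ S) (x∉p⇒x∈∁p i∉S)
  ...     | j , refl = inj₁ j , Φ.preserves-InArc tt tt tt between

  pos : Fin n → Bool → ℕ
  pos x = place (s x) (x , refl)

  cornerG : Fin (∣ ∁ S ∣ + k₂) → ℕ
  cornerG = corner⊎ ∘ splitAt ∣ ∁ S ∣

  cornerG-injective : ∀ g h → cornerG g ≡ cornerG h → g ≡ h
  cornerG-injective g h eq = begin
    g                    ≡⟨ Finₚ.join-splitAt _ k₂ g ⟨
    join _ k₂ (parts g)  ≡⟨ cong (join _ k₂) (corner⊎-injective (parts g) (parts h) eq) ⟩
    join _ k₂ (parts h)  ≡⟨ Finₚ.join-splitAt _ k₂ h ⟩
    h                    ∎
    where
    open ≡-Reasoning
    parts : Fin (∣ ∁ S ∣ + k₂) → Fin ∣ ∁ S ∣ ⊎ Fin k₂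
    parts = splitAt ∣ ∁ S ∣

  cornerG-between : ∀ x c → ∃ λ g → InArc (pos x c) (pos x (not c)) (cornerG g)
  cornerG-between x c with corner⊎-between (s x) (x , refl) c
  ... | u , between =
    join _ k₂ u , subst (InArc _ _) (cong corner⊎ (≡-sym (Finₚ.splitAt-join _ k₂ u))) between

  polygonRep : PolygonRep G (k₁ + k₂ ∸ ∣ S ∣)
  polygonRep = subst (PolygonRep G) size
    (FromEndpoints.polygonRep Finₚ._≟_ pos (λ x y → place-injective (s x) (s y) (x , refl) (y , refl)) G
      (λ x y → adj-place (s x) (s y) (x , refl) (y , refl))
      (≤-trans (2≤k P₂) (m≤n+m k₂ _)) cornerG cornerG-injective
      (λ g x → corner⊎≢place (splitAt _ g) (s x) (x , refl)) cornerG-between)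
    where
    size : ∣ ∁ S ∣ + k₂ ≡ k₁ + k₂ ∸ ∣ S ∣
    size = trans (cong (_+ k₂) (∣∁p∣≡n∸∣p∣ S)) (≡-sym (+-∸-comm k₂ (∣p∣≤n S)))

lemma1 : ∀ {n : ℕ} (G : Graph (Fin n)) (s : Fin n → Bool) →
    IsCircleGraph G → IsSplit G s →
    (∀ k₁ k₂ → PolygonRep (G₁ G s) k₁ → PolygonRep (G₂ G s) k₂ →
       PolygonRep G (k₁ + k₂))
    × (∀ k₁ k₂ q → (P₁ : PolygonRep (G₁ G s) k₁) →
       CloseToCorners P₁ marker q → PolygonRep (G₂ G s) k₂ →
       PolygonRep G (k₁ + k₂ ∸ q))
lemma1 G s _ split = glue-all , glue-close
  where
  glue-all : ∀ k₁ k₂ → PolygonRep (G₁ G s) k₁ → PolygonRep (G₂ G s) k₂ → PolygonRep G (k₁ + k₂)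
  glue-all k₁ k₂ P₁ P₂ = subst (λ q → PolygonRep G (k₁ + k₂ ∸ q)) (∣⊥∣≡0 k₁)
    (Glue.polygonRep G s split P₁ P₂ Subset.⊥ (λ _ i∈⊥ → contradiction i∈⊥ ∉⊥))
  glue-close : ∀ k₁ k₂ q → (P₁ : PolygonRep (G₁ G s) k₁) →
    CloseToCorners P₁ marker q → PolygonRep (G₂ G s) k₂ → PolygonRep G (k₁ + k₂ ∸ q)
  glue-close k₁ k₂ q P₁ (S , S⇔close , ∣S∣≡q) P₂ = subst (λ q → PolygonRep G (k₁ + k₂ ∸ q)) ∣S∣≡q
    (Glue.polygonRep G s split P₁ P₂ S (λ i → to (S⇔close i)))
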